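{- Let $\mathcal{H}$ be a pseudohalfplane hypergraph on $V$ with witnessing ABA-free hypergraph $\mathcal{F}$, and let $C$ be its set of extremal vertices with the circular order defined below. Let $p,q\in C$ be two extremal vertices that are not consecutive in the circular order, so that $C\setminus\{p,q\}$ is the union of two intervals $I_1,I_2$ of the circular order. If $H_1,H_2\in\mathcal{H}$ satisfy $H_1\cap C\subseteq I_1$ and $H_2\cap C\subseteq I_2$, then $H_1\cap H_2=\emptyset$.
   Context: Let $V=\{v_1<v_2<\dots<v_n\}$ be a finite totally ordered set. A hypergraph $\mathcal{F}$ on $V$ is ABA-free if there are no two hyperedges $A,B\in\mathcal{F}$ and vertices $x<y<z$ with $x,z\in A\setminus B$ and $y\in B\setminus A$. Let $\bar{\mathcal{F}}=\{V\setminus F: F\in\mathcal{F}\}$. $\mathcal{H}$ is a pseudohalfplane hypergraph if $\mathcal{H}\subseteq\mathcal{F}\cup\bar{\mathcal{F}}$ for some ABA-free $\mathcal{F}$ on $V$; fix such an $\mathcal{F}$. A vertex $a$ is skippable in a hypergraph $\mathcal{G}$ on $V$ if some $A\in\mathcal{G}$ has $\min(A)<a<\max(A)$ and $a\notin A$, and unskippable otherwise. Topvertices are the unskippable vertices of $\mathcal{F}$, bottomvertices are the unskippable vertices of $\bar{\mathcal{F}}$; $v_1$ and $v_n$ are both. $C$ is the set of topvertices together with the bottomvertices. Let $t_1=v_1<t_2<\dots<t_k=v_n$ be the topvertices and $b_1=v_1<b_2<\dots<b_l=v_n$ the bottomvertices. The circular order on $C$ is the cyclic sequence $(v_1,t_2,\dots,t_{k-1},v_n,b_{l-1},\dots,b_2)$;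 an interval is a set of cyclically consecutive elements of this sequence. -}

module Defs where

open import Data.Nat as ℕ using (ℕ; suc; _∸_; _*_)
open import Data.Fin using (Fin; toℕ; _<_)
open import Data.Fin.Subset using (Subset; _∈_; _∉_; ∁)
open import Data.List using (List; map)
import Data.List.Membership.Propositional as LM
open import Data.Product using (Σ; ∃; ∃₂; _×_; _,_)
open import Data.Sum using (_⊎_)
open import Data.Empty using (⊥)
open import Relation.Nullary using (¬_)
open import Relation.Binary.PropositionalEquality using (_≡_; _≢_)

-- Vertex set V = Fin n, totally ordered by Data.Fin._<_ (v₁ = index 0, vₙ = index n-1).
-- A hypergraph on V is a finite list of hyperedges (subsets of V).
Hypergraph : ℕ → Set
Hypergraph n = List (Subset n)

_∈ₕ_ : ∀ {n} → Subset n → Hypergraph n → Set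
A ∈ₕ G = A LM.∈ G

ABAFree : ∀ {n} → Hypergraph n → Set
ABAFree {n} F =
  ∀ {A B} → A ∈ₕ F → B ∈ₕ F → ∀ {x y z : Fin n} → x < y → y < z →
  x ∈ A → x ∉ B → z ∈ A → z ∉ B → y ∈ B → y ∉ A → ⊥

complementFamily : ∀ {n} → Hypergraph n → Hypergraph n
complementFamily F = map ∁ F

PseudohalfplaneWitness : ∀ {n} → Hypergraph n → Hypergraph n → Set
PseudohalfplaneWitness F H = ∀ {X} → X ∈ₕ H → X ∈ₕ F ⊎ X ∈ₕ complementFamily F

-- a is skippable in G: some A ∈ G with min(A) < a < max(A) and a ∉ A
-- (min(A) < a < max(A) written out as: some x, z ∈ A with x < a < z).
Skippable : ∀ {n} → Hypergraph n → Fin n → Set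
Skippable G a =
  ∃ λ A → A ∈ₕ G × a ∉ A × ∃₂ λ x z → x ∈ A × z ∈ A × x < a × a < z

Topvertex : ∀ {n} → Hypergraph n → Fin n → Set
Topvertex F a = ¬ Skippable F a

Bottomvertex : ∀ {n} → Hypergraph n → Fin n → Set
Bottomvertex F a = ¬ Skippable (complementFamily F) a

InC : ∀ {n} → Hypergraph n → Fin n → Set
InC F a = Topvertex F a ⊎ Bottomvertex F a

-- Entries of the cyclic sequence (v₁, t₂, …, t_{k-1}, vₙ, b_{l-1}, …, b₂):
-- an entry is a topvertex on the "top" side, or a bottomvertex other than
-- v₁, vₙ on the "bottom" side.
data Side : Set where
  top bottom : Side

IsEntry : ∀ {n} → Hypergraph n → Side → Fin n → Set
IsEntry F top v = Topvertex F v
IsEntry {n} F bottom v = Bottomvertex F v × toℕ v ≢ 0 × suc (toℕ v) ≢ n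

-- Position of an entry in the cyclic sequence: top entries t at toℕ t,
-- bottom entries b at 2(n-1) - toℕ b (so listed in decreasing order after vₙ).
coord : ∀ {n} → Side → Fin n → ℕ
coord top v = toℕ v
coord {n} bottom v = 2 * (n ∸ 1) ∸ toℕ v

-- c lies strictly between i and j when going cyclically forward from i to j.
CycBetween : ℕ → ℕ → ℕ → Set
CycBetween i c j =
  (i ℕ.< c × c ℕ.< j) ⊎ (j ℕ.< i × i ℕ.< c) ⊎ (j ℕ.< i × c ℕ.< j)

ArcNonempty : ∀ {n} → Hypergraph n → Side → Fin n → Side → Fin n → Set
ArcNonempty {n} F sp p sq q =
  ∃₂ λ (s : Side) (v : Fin n) → IsEntry F s v × CycBetween (coord sp p) (coord s v) (coord sq q)

-- v belongs to the interval of C∖{p,q} going cyclically forward from (sp,p) to (sq,q).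
InOpenArc : ∀ {n} → Hypergraph n → Side → Fin n → Side → Fin n → Fin n → Set
InOpenArc F sp p sq q v =
  v ≢ p × v ≢ q ×
  ∃ λ (s : Side) → IsEntry F s v × CycBetween (coord sp p) (coord s v) (coord sq q)

{-# OPTIONS --safe #-}
-- Suppose v lies in both hyperedges. Every hyperedge of F contains a topvertex and every
-- hyperedge of F̄ a bottomvertex (an ABA-free family always has an unskippable vertex in each
-- hyperedge). These hull vertices of H₁ and H₂ sit in opposite arcs, so walking along the
-- circular order from one to the other passes the endpoint p or q. That endpoint is a
-- topvertex (resp. bottomvertex) lying, in the order of V, between v and a hull vertex of a
-- hyperedge of F (resp. F̄) that avoids it, so it would be skippable. When one hyperedge is in
-- F and the other in F̄, ABA-freeness first puts v on the same side of p and q.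
module Submission where

open import Defs
open import Data.Empty using (⊥; ⊥-elim)
open import Data.Fin as Fin using (Fin; toℕ; fromℕ<)
open import Data.Fin.Induction using (<-wellFounded)
open import Data.Fin.Properties using (toℕ-injective; toℕ<n; toℕ≤pred[n]; toℕ-fromℕ<)
open import Data.Fin.Subset using (Subset; _∈_; _∉_; ∁; _∩_; Empty)
open import Data.Fin.Subset.Properties
  using (_∈?_; x∈p∩q⁻; x∈∁p⇒x∉p; x∉∁p⇒x∈p; x∉p⇒x∈∁p; x∈p⇒x∉∁p)
open import Data.List.Membership.Propositional.Properties using (∈-map⁺; ∈-map⁻)
open import Data.Nat using (ℕ; zero; suc; _+_; _*_; _∸_; _≤_; _<_; s≤s⁻¹)
open import Data.Nat.Properties
open import Data.Product using (∃; ∃₂; ∃-syntax; _×_; _,_; proj₁; proj₂)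
open import Data.Sum using (_⊎_; inj₁; inj₂)
open import Induction.WellFounded using (Acc; acc)
open import Relation.Binary using (Tri; tri<; tri≈; tri>)
open import Relation.Binary.PropositionalEquality
  using (_≡_; _≢_; refl; sym; trans; cong; subst; ≢-sym; module ≡-Reasoning)
open import Function using (_∘_; case_of_)
open import Relation.Nullary using (¬_; yes; no)

-- The cyclic order on ℕ

CycBetween-disjoint : ∀ {i c j} → CycBetween i c j → ¬ CycBetween j c i
CycBetween-disjoint (inj₁ (i<c , c<j)) (inj₁ (j<c , c<i))        = <-asym c<j j<c
CycBetween-disjoint (inj₁ (i<c , c<j)) (inj₂ (inj₁ (_ , j<c)))   = <-asym c<j j<c
CycBetween-disjoint (inj₁ (i<c , c<j)) (inj₂ (inj₂ (_ , c<i)))   = <-asym i<c c<i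
CycBetween-disjoint (inj₂ (inj₁ (_ , i<c))) (inj₁ (_ , c<i))     = <-asym i<c c<i
CycBetween-disjoint (inj₂ (inj₁ (j<i , _))) (inj₂ (inj₁ (i<j , _))) = <-asym j<i i<j
CycBetween-disjoint (inj₂ (inj₁ (j<i , _))) (inj₂ (inj₂ (i<j , _))) = <-asym j<i i<j
CycBetween-disjoint (inj₂ (inj₂ (_ , c<j))) (inj₁ (j<c , _))     = <-asym c<j j<c
CycBetween-disjoint (inj₂ (inj₂ (j<i , _))) (inj₂ (inj₁ (i<j , _))) = <-asym j<i i<j
CycBetween-disjoint (inj₂ (inj₂ (j<i , _))) (inj₂ (inj₂ (i<j , _))) = <-asym j<i i<j

CycBetween-separate : ∀ {i j x y} → CycBetween i x j → CycBetween j y i → CycBetween x j y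
CycBetween-separate (inj₁ (i<x , x<j)) (inj₁ (j<y , y<i)) =
  ⊥-elim (<-asym (<-trans i<x x<j) (<-trans j<y y<i))
CycBetween-separate (inj₁ (_ , x<j)) (inj₂ (inj₁ (_ , j<y))) = inj₁ (x<j , j<y)
CycBetween-separate (inj₁ (i<x , x<j)) (inj₂ (inj₂ (_ , y<i))) = inj₂ (inj₁ (<-trans y<i i<x , x<j))
CycBetween-separate (inj₂ (inj₁ (_ , i<x))) (inj₁ (j<y , y<i)) = inj₂ (inj₂ (<-trans y<i i<x , j<y))
CycBetween-separate (inj₂ (inj₁ (j<i , _))) (inj₂ (inj₁ (i<j , _))) = ⊥-elim (<-asym j<i i<j)
CycBetween-separate (inj₂ (inj₁ (j<i , _))) (inj₂ (inj₂ (i<j , _))) = ⊥-elim (<-asym j<i i<j)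
CycBetween-separate (inj₂ (inj₂ (_ , x<j))) (inj₁ (j<y , _)) = inj₁ (x<j , j<y)
CycBetween-separate (inj₂ (inj₂ (j<i , _))) (inj₂ (inj₁ (i<j , _))) = ⊥-elim (<-asym j<i i<j)
CycBetween-separate (inj₂ (inj₂ (j<i , _))) (inj₂ (inj₂ (i<j , _))) = ⊥-elim (<-asym j<i i<j)

CycBetween-linear : ∀ {i c j} → i ≤ j → CycBetween i c j → i < c × c < j
CycBetween-linear _   (inj₁ i<c<j)           = i<c<j
CycBetween-linear i≤j (inj₂ (inj₁ (j<i , _))) = ⊥-elim (<⇒≱ j<i i≤j)
CycBetween-linear i≤j (inj₂ (inj₂ (j<i , _))) = ⊥-elim (<⇒≱ j<i i≤j)

CycBetween-after⊎before : ∀ {i c j} → CycBetween i c j → i < c ⊎ c < j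
CycBetween-after⊎before (inj₁ (i<c , _))        = inj₁ i<c
CycBetween-after⊎before (inj₂ (inj₁ (_ , i<c))) = inj₁ i<c
CycBetween-after⊎before (inj₂ (inj₂ (_ , c<j))) = inj₂ c<j

CycBetween-from-0 : ∀ {c j} → CycBetween 0 c j → c < j
CycBetween-from-0 (inj₁ (_ , c<j))     = c<j
CycBetween-from-0 (inj₂ (inj₁ (() , _)))
CycBetween-from-0 (inj₂ (inj₂ (() , _)))

CycBetween-to-0 : ∀ {i c} → CycBetween i c 0 → i < c
CycBetween-to-0 (inj₁ (_ , ()))
CycBetween-to-0 (inj₂ (inj₁ (_ , i<c))) = i<c
CycBetween-to-0 (inj₂ (inj₂ (_ , ())))

CycBetween-trichotomy : ∀ {i c j} → c ≢ i → c ≢ j → i ≢ j → CycBetween i c j ⊎ CycBetween j c i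
CycBetween-trichotomy {i} {c} {j} c≢i c≢j i≢j with <-cmp i j | <-cmp c i | <-cmp c j
... | tri≈ _ i≡j _ | _            | _            = ⊥-elim (i≢j i≡j)
... | _            | tri≈ _ c≡i _ | _            = ⊥-elim (c≢i c≡i)
... | _            | _            | tri≈ _ c≡j _ = ⊥-elim (c≢j c≡j)
... | tri< i<j _ _ | tri< c<i _ _ | _            = inj₂ (inj₂ (inj₂ (i<j , c<i)))
... | tri< _ _ _   | tri> _ _ i<c | tri< c<j _ _ = inj₁ (inj₁ (i<c , c<j))
... | tri< i<j _ _ | tri> _ _ _   | tri> _ _ j<c = inj₂ (inj₂ (inj₁ (i<j , j<c)))
... | tri> _ _ j<i | _            | tri< c<j _ _ = inj₁ (inj₂ (inj₂ (j<i , c<j)))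
... | tri> _ _ j<i | tri> _ _ i<c | tri> _ _ _   = inj₁ (inj₂ (inj₁ (j<i , i<c)))
... | tri> _ _ _   | tri< c<i _ _ | tri> _ _ j<c = inj₂ (inj₁ (j<c , c<i))

-- Skippable vertices and ABA-free families

module _ {n} {G : Hypergraph n} where

  skippable-between : ∀ {A x w z} → A ∈ₕ G → x ∈ A → z ∈ A → w ∉ A →
                      toℕ x < toℕ w → toℕ w < toℕ z → Skippable G w
  skippable-between A∈ x∈ z∈ w∉ x<w w<z = _ , A∈ , w∉ , _ , _ , x∈ , z∈ , x<w , w<z

  skippable-between-hyperedges : ∀ {H₁ H₂ v c₁ c₂ w} → H₁ ∈ₕ G → H₂ ∈ₕ G → v ∈ H₁ → v ∈ H₂ →
                                 c₁ ∈ H₁ → c₂ ∈ H₂ → w ∉ H₁ → w ∉ H₂ →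
                                 toℕ c₁ < toℕ w → toℕ w < toℕ c₂ → Skippable G w
  skippable-between-hyperedges {v = v} {w = w} H₁∈ H₂∈ v∈₁ v∈₂ c₁∈ c₂∈ w∉₁ w∉₂ c₁<w w<c₂
    with <-cmp (toℕ w) (toℕ v)
  ... | tri< w<v _ _ = skippable-between H₁∈ c₁∈ v∈₁ w∉₁ c₁<w w<v
  ... | tri≈ _ w≡v _ = ⊥-elim (w∉₁ (subst (_∈ _) (toℕ-injective (sym w≡v)) v∈₁))
  ... | tri> _ _ v<w = skippable-between H₂∈ v∈₂ c₂∈ w∉₂ v<w w<c₂

SkippableBelow : ∀ {n} → Hypergraph n → ℕ → Fin n → Set
SkippableBelow G k a =
  ∃ λ A → A ∈ₕ G × a ∉ A × ∃₂ λ x z → x ∈ A × z ∈ A × toℕ x < toℕ a × toℕ a < toℕ z × toℕ z < k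

module _ {n} {G : Hypergraph n} (aba : ABAFree G) where

  -- When vertex k misses A, a candidate t that becomes skippable is skipped by some E through
  -- k; the induction hypothesis for E gives, by ABA-freeness, a smaller candidate in A, so the
  -- descent ends at a good one.
  hyperedge-has-unskippable-below : ∀ k → k ≤ n → ∀ {A u} → A ∈ₕ G → u ∈ A → toℕ u < k →
                                    ¬ ¬ (∃[ t ] (t ∈ A × toℕ t < k × ¬ SkippableBelow G k t))
  hyperedge-has-unskippable-below zero    _   _  _  ()
  hyperedge-has-unskippable-below (suc k) k<n {A} {u} A∈ u∈ u<1+k none
    with fromℕ< k<n ∈? A | toℕ-fromℕ< k<n
  ... | yes k∈A | toℕk≡k =
    none (fromℕ< k<n , k∈A , subst (_< suc k) (sym toℕk≡k) (n<1+n k) , last-unskipped)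
    where
    last-unskipped : ¬ SkippableBelow G (suc k) (fromℕ< k<n)
    last-unskipped (_ , _ , _ , _ , _ , _ , _ , _ , k<z , z<1+k) =
      <⇒≱ (subst (_< _) toℕk≡k k<z) (s≤s⁻¹ z<1+k)
  ... | no k∉A | toℕk≡k =
    hyperedge-has-unskippable-below k (<⇒≤ k<n) A∈ u∈ u<k
      λ (t , t∈ , t<k , t-ok) → descend t (<-wellFounded t) t∈ t<k t-ok
    where
    is-k : ∀ {z} → toℕ z ≡ k → z ∉ A
    is-k z≡k z∈A = k∉A (subst (_∈ A) (toℕ-injective (trans z≡k (sym toℕk≡k))) z∈A)

    u<k : toℕ u < k
    u<k = ≤∧≢⇒< (s≤s⁻¹ u<1+k) (λ u≡k → is-k u≡k u∈)

    descend : ∀ t → Acc Fin._<_ t → t ∈ A → toℕ t < k → ¬ SkippableBelow G k t → ⊥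
    descend t (acc smaller) t∈A t<k t-ok = none (t , t∈A , m<n⇒m<1+n t<k , t-ok′)
      where
      t-ok′ : ¬ SkippableBelow G (suc k) t
      t-ok′ (E , E∈ , t∉E , x , z , x∈E , z∈E , x<t , t<z , z<1+k)
        with m≤n⇒m<n∨m≡n (s≤s⁻¹ z<1+k)
      ... | inj₁ z<k = t-ok (E , E∈ , t∉E , x , z , x∈E , z∈E , x<t , t<z , z<k)
      ... | inj₂ z≡k =
        hyperedge-has-unskippable-below k (<⇒≤ k<n) E∈ x∈E (<-trans x<t t<k)
          λ (t′ , t′∈E , t′<k , t′-ok) → compare t′ t′∈E t′<k t′-ok (<-cmp (toℕ t′) (toℕ t))
        where
        compare : ∀ t′ → t′ ∈ E → toℕ t′ < k → ¬ SkippableBelow G k t′ →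
                  Tri (toℕ t′ < toℕ t) (toℕ t′ ≡ toℕ t) (toℕ t < toℕ t′) → ⊥
        compare t′ t′∈E _ _ (tri≈ _ t′≡t _) = t∉E (subst (_∈ E) (toℕ-injective t′≡t) t′∈E)
        compare t′ t′∈E t′<k _ (tri> _ _ t<t′) =
          t-ok (E , E∈ , t∉E , x , t′ , x∈E , t′∈E , x<t , t<t′ , t′<k)
        compare t′ t′∈E t′<k t′-ok (tri< t′<t _ _) with t′ ∈? A
        ... | yes t′∈A = descend t′ (smaller t′<t) t′∈A t′<k t′-ok
        ... | no t′∉A  = aba E∈ A∈ t′<t t<z t′∈E t′∉A z∈E (is-k z≡k) t∈A t∉E

  hyperedge-has-topvertex : ∀ {A u} → A ∈ₕ G → u ∈ A → ¬ ¬ (∃[ t ] (t ∈ A × Topvertex G t))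
  hyperedge-has-topvertex A∈ u∈ none =
    hyperedge-has-unskippable-below n ≤-refl A∈ u∈ (toℕ<n _) λ (t , t∈ , _ , t-ok) →
      none (t , t∈ , λ (E , E∈ , t∉ , x , z , x∈ , z∈ , x<t , t<z) →
        t-ok (E , E∈ , t∉ , x , z , x∈ , z∈ , x<t , t<z , toℕ<n z))

module _ {n} {F : Hypergraph n} where

  ∈-complementFamily⁻ : ∀ {X} → X ∈ₕ complementFamily F → ∃[ A ] (A ∈ₕ F × X ≡ ∁ A)
  ∈-complementFamily⁻ = ∈-map⁻ ∁

  complementFamily-ABAFree : ABAFree F → ABAFree (complementFamily F)
  complementFamily-ABAFree aba A′∈ B′∈ x<y y<z x∈A′ x∉B′ z∈A′ z∉B′ y∈B′ y∉A′
    with ∈-complementFamily⁻ A′∈ | ∈-complementFamily⁻ B′∈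
  ... | A , A∈ , refl | B , B∈ , refl =
    aba B∈ A∈ x<y y<z (x∉∁p⇒x∈p x∉B′) (x∈∁p⇒x∉p x∈A′) (x∉∁p⇒x∈p z∉B′) (x∈∁p⇒x∉p z∈A′)
        (x∉∁p⇒x∈p y∉A′) (x∈∁p⇒x∉p y∈B′)

  sandwiched-not-top-and-bottom : ∀ {X a b c} → X ∈ₕ F ⊎ X ∈ₕ complementFamily F →
                                  c ∈ X → a ∉ X → b ∉ X → toℕ a < toℕ c → toℕ c < toℕ b →
                                  Topvertex F c → Bottomvertex F c → ⊥
  sandwiched-not-top-and-bottom (inj₁ X∈F) c∈ a∉ b∉ a<c c<b _ is-bottom =
    is-bottom (skippable-between (∈-map⁺ ∁ X∈F) (x∉p⇒x∈∁p a∉) (x∉p⇒x∈∁p b∉) (x∈p⇒x∉∁p c∈) a<c c<b)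
  sandwiched-not-top-and-bottom (inj₂ X∈F̄) c∈ a∉ b∉ a<c c<b is-top _
    with ∈-complementFamily⁻ X∈F̄
  ... | A , A∈ , refl =
    is-top (skippable-between A∈ (x∉∁p⇒x∈p a∉) (x∉∁p⇒x∈p b∉) (x∈∁p⇒x∉p c∈) a<c c<b)

2m∸n≡m+[m∸n] : ∀ {m n} → n ≤ m → 2 * m ∸ n ≡ m + (m ∸ n)
2m∸n≡m+[m∸n] {m} {n} n≤m = trans (cong (λ k → m + k ∸ n) (+-identityʳ m)) (+-∸-assoc m n≤m)

m≤2m∸n : ∀ {m n} → n ≤ m → m ≤ 2 * m ∸ n
m≤2m∸n {m} n≤m = subst (m ≤_) (sym (2m∸n≡m+[m∸n] n≤m)) (m≤m+n m _)

m<2m∸n : ∀ {m n} → n < m → m < 2 * m ∸ n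
m<2m∸n {m} n<m = subst (m <_) (sym (2m∸n≡m+[m∸n] (<⇒≤ n<m))) (m<m+n m (m<n⇒0<n∸m n<m))

n≤2m : ∀ {m n} → n ≤ m → n ≤ 2 * m
n≤2m {m} n≤m = ≤-trans n≤m (m≤m+n m _)

-- v₁ and vₙ occur in the cyclic sequence only as topvertices, at positions 0 and m = 2m ∸ m.
bottomPosition : ∀ {m} → Fin (suc m) → ℕ
bottomPosition Fin.zero          = 0
bottomPosition {m} c@(Fin.suc _) = 2 * m ∸ toℕ c

module _ {m} (F : Hypergraph (suc m)) where

  bottom-entry-interior : ∀ {r : Fin (suc m)} → IsEntry F bottom r → 0 < toℕ r × toℕ r < m
  bottom-entry-interior {r} (_ , r≢0 , r≢last) =
    n≢0⇒n>0 r≢0 , ≤∧≢⇒< (toℕ≤pred[n] r) (λ r≡m → r≢last (cong suc r≡m))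

  coord-top : ∀ {s} {r : Fin (suc m)} → IsEntry F s r → coord s r ≤ m →
              Topvertex F r × coord s r ≡ toℕ r
  coord-top {top}    is-top _   = is-top , refl
  coord-top {bottom} entry ≤m  = ⊥-elim (<⇒≱ (m<2m∸n (proj₂ (bottom-entry-interior entry))) ≤m)

  coord-bottom : ∀ {s} {r : Fin (suc m)} → IsEntry F s r → m < coord s r →
                 Bottomvertex F r × 0 < toℕ r × coord s r ≡ 2 * m ∸ toℕ r
  coord-bottom {top}    {r} _ m< = ⊥-elim (<⇒≱ m< (toℕ≤pred[n] r))
  coord-bottom {bottom} entry _  = proj₁ entry , proj₁ (bottom-entry-interior entry) , refl

  topvertex-left-of : ∀ {s} {r c : Fin (suc m)} → IsEntry F s r → coord s r < toℕ c →
                      Topvertex F r × toℕ r < toℕ c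
  topvertex-left-of {c = c} entry r<c with coord-top entry (<⇒≤ (<-≤-trans r<c (toℕ≤pred[n] c)))
  ... | is-top , r≡ = is-top , subst (_< toℕ c) r≡ r<c

  topvertex-right-of : ∀ {s} {r c : Fin (suc m)} → IsEntry F s r → coord s r ≤ m →
                       toℕ c < coord s r → Topvertex F r × toℕ c < toℕ r
  topvertex-right-of {c = c} entry ≤m c<r with coord-top entry ≤m
  ... | is-top , r≡ = is-top , subst (toℕ c <_) r≡ c<r

  bottomvertex-left-of : ∀ {s} {r c : Fin (suc m)} → IsEntry F s r → 2 * m ∸ toℕ c < coord s r →
                         Bottomvertex F r × toℕ r < toℕ c
  bottomvertex-left-of {c = c} entry c<r
    with coord-bottom entry (≤-<-trans (m≤2m∸n (toℕ≤pred[n] c)) c<r)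
  ... | is-bottom , _ , r≡ = is-bottom , ∸-cancelʳ-< (subst (2 * m ∸ toℕ c <_) r≡ c<r)

  bottomvertex-right-of : ∀ {s} {r c : Fin (suc m)} → IsEntry F s r → m < coord s r →
                          coord s r < 2 * m ∸ toℕ c → Bottomvertex F r × toℕ c < toℕ r
  bottomvertex-right-of {c = c} entry m< r<c with coord-bottom entry m<
  ... | is-bottom , _ , r≡ = is-bottom , ∸-cancelʳ-< (subst (_< 2 * m ∸ toℕ c) r≡ r<c)

  coord-injective : ∀ {s s′} {a b : Fin (suc m)} → IsEntry F s a → IsEntry F s′ b →
                    coord s a ≡ coord s′ b → a ≡ b
  coord-injective {s} {s′} {a} {b} ea eb a≡b with ≤-<-connex (coord s a) m
  ... | inj₁ ≤m = toℕ-injective (begin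
    toℕ a       ≡⟨ sym (proj₂ (coord-top ea ≤m)) ⟩
    coord s a   ≡⟨ a≡b ⟩
    coord s′ b  ≡⟨ proj₂ (coord-top eb (subst (_≤ m) a≡b ≤m)) ⟩
    toℕ b       ∎)
    where open ≡-Reasoning
  ... | inj₂ m< =
    toℕ-injective (∸-cancelˡ-≡ (n≤2m (toℕ≤pred[n] a)) (n≤2m (toℕ≤pred[n] b)) (begin
    2 * m ∸ toℕ a  ≡⟨ sym (proj₂ (proj₂ (coord-bottom ea m<))) ⟩
    coord s a      ≡⟨ a≡b ⟩
    coord s′ b     ≡⟨ proj₂ (proj₂ (coord-bottom eb (subst (m <_) a≡b m<))) ⟩
    2 * m ∸ toℕ b  ∎))
    where open ≡-Reasoning

  -- The positions toℕ w and 2m ∸ toℕ w of a vertex w cut the circle into the entries right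
  -- of w and the entries left of w.
  CycBetween-mirror-right : ∀ {s} {r w : Fin (suc m)} → IsEntry F s r →
                            CycBetween (toℕ w) (coord s r) (2 * m ∸ toℕ w) → toℕ w < toℕ r
  CycBetween-mirror-right {s} {r} {w} entry cy
    with CycBetween-linear (≤-trans (toℕ≤pred[n] w) (m≤2m∸n (toℕ≤pred[n] w))) cy
       | ≤-<-connex (coord s r) m
  ... | w<r , _   | inj₁ ≤m = proj₂ (topvertex-right-of entry ≤m w<r)
  ... | _ , r<w′  | inj₂ m< = proj₂ (bottomvertex-right-of entry m< r<w′)

  CycBetween-mirror-left : ∀ {s} {r w : Fin (suc m)} → IsEntry F s r →
                           CycBetween (2 * m ∸ toℕ w) (coord s r) (toℕ w) → toℕ r < toℕ w
  CycBetween-mirror-left entry cy with CycBetween-after⊎before cy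
  ... | inj₁ w′<r = proj₂ (bottomvertex-left-of entry w′<r)
  ... | inj₂ r<w  = proj₂ (topvertex-left-of entry r<w)

  bottomvertex-entry : ∀ {c} → Bottomvertex F c →
                       ∃[ s ] (IsEntry F s c × coord s c ≡ bottomPosition c)
  bottomvertex-entry {Fin.zero} _ = top , (λ { (_ , _ , _ , _ , _ , _ , _ , () , _) }) , refl
  bottomvertex-entry {c@(Fin.suc _)} is-bottom with toℕ c ≟ m
  ... | yes c≡m = top , last-top , trans c≡m (sym (begin
    2 * m ∸ toℕ c  ≡⟨ cong (2 * m ∸_) c≡m ⟩
    2 * m ∸ m      ≡⟨ 2m∸n≡m+[m∸n] {m} ≤-refl ⟩
    m + (m ∸ m)    ≡⟨ cong (m +_) (n∸n≡0 m) ⟩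
    m + 0          ≡⟨ +-identityʳ m ⟩
    m              ∎))
    where
    open ≡-Reasoning
    last-top : Topvertex F c
    last-top (_ , _ , _ , _ , z , _ , _ , _ , c<z) =
      <⇒≱ (subst (_< toℕ z) c≡m c<z) (toℕ≤pred[n] z)
  ... | no c≢m = bottom , (is-bottom , (λ ()) , λ c≡m → c≢m (suc-injective c≡m)) , refl

-- Hyperedges confined to an arc

ConfinedTo : ∀ {n} → Hypergraph n → Subset n → Side → Fin n → Side → Fin n → Set
ConfinedTo F X sa a sb b = ∀ v → v ∈ X → InC F v → InOpenArc F sa a sb b v

record ArcConfined {n} (F : Hypergraph n) (X : Subset n) (sa : Side) (a : Fin n)
                   (sb : Side) (b : Fin n) : Set where
  field
    start∉ : a ∉ X
    end∉   : b ∉ X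
    occurrence : ∀ {s c} → c ∈ X → IsEntry F s c → CycBetween (coord sa a) (coord s c) (coord sb b)

open ArcConfined

entry-InC : ∀ {n} {F : Hypergraph n} {s v} → IsEntry F s v → InC F v
entry-InC {s = top}    is-top = inj₁ is-top
entry-InC {s = bottom} entry = inj₂ (proj₁ entry)

module _ {m} (F : Hypergraph (suc m)) where

  -- The hypothesis places only one occurrence of c in the arc. A vertex that is both a
  -- topvertex and a bottomvertex occurs twice; were its occurrences in different arcs, it would
  -- lie strictly between the two endpoints, which avoid X, and so be skippable in F or in F̄.
  ConfinedTo⇒ArcConfined : ∀ {X sa a sb b} → X ∈ₕ F ⊎ X ∈ₕ complementFamily F →
                IsEntry F sa a → IsEntry F sb b → a ≢ b → ConfinedTo F X sa a sb b →
                ArcConfined F X sa a sb b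
  ConfinedTo⇒ArcConfined {X} {sa} {a} {sb} {b} family ea eb a≢b confined = record
    { start∉ = start∉′ ; end∉ = end∉′ ; occurrence = occurrence′ }
    where
    start∉′ : a ∉ X
    start∉′ a∈ = proj₁ (confined a a∈ (entry-InC ea)) refl

    end∉′ : b ∉ X
    end∉′ b∈ = proj₁ (proj₂ (confined b b∈ (entry-InC eb))) refl

    occurrence′ : ∀ {s c} → c ∈ X → IsEntry F s c →
                  CycBetween (coord sa a) (coord s c) (coord sb b)
    occurrence′ {s} {c} c∈ e with confined c c∈ (entry-InC e)
    ... | c≢a , c≢b , s′ , e′ , cy′
      with CycBetween-trichotomy (c≢a ∘ coord-injective F e ea) (c≢b ∘ coord-injective F e eb)
                                 (a≢b ∘ coord-injective F ea eb)
    ... | inj₁ cy = cy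
    ... | inj₂ cy = ⊥-elim (opposite s s′ e e′ cy′ cy)
      where
      opposite : ∀ s s′ → IsEntry F s c → IsEntry F s′ c →
                 CycBetween (coord sa a) (coord s′ c) (coord sb b) →
                 CycBetween (coord sb b) (coord s c) (coord sa a) → ⊥
      opposite top    top    _   _ cy′ cy = CycBetween-disjoint cy′ cy
      opposite bottom bottom _   _ cy′ cy = CycBetween-disjoint cy′ cy
      opposite top    bottom is-top (is-bottom , _) cy′ cy =
        sandwiched-not-top-and-bottom family c∈ end∉′ start∉′
          (CycBetween-mirror-left F eb (CycBetween-separate cy′ cy))
          (CycBetween-mirror-right F ea (CycBetween-separate cy cy′)) is-top is-bottom
      opposite bottom top (is-bottom , _) is-top cy′ cy =
        sandwiched-not-top-and-bottom family c∈ start∉′ end∉′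
          (CycBetween-mirror-left F ea (CycBetween-separate cy cy′))
          (CycBetween-mirror-right F eb (CycBetween-separate cy′ cy)) is-top is-bottom

bottomvertex-occurrence : ∀ {m} {F : Hypergraph (suc m)} {X sa a sb b c} →
                          ArcConfined F X sa a sb b → c ∈ X → Bottomvertex F c →
                          CycBetween (coord sa a) (bottomPosition c) (coord sb b)
bottomvertex-occurrence {F = F} {sa = sa} {a} {sb} {b} arc c∈ c-bottom
  with bottomvertex-entry F c-bottom
... | _ , entry , at-bottomPosition =
  subst (λ x → CycBetween (coord sa a) x (coord sb b)) at-bottomPosition (occurrence arc c∈ entry)

-- Hull vertices of hyperedges in opposite arcs

module _ {m} (F : Hypergraph (suc m)) where

  ordered-topvertices-apart : ∀ {H₁ H₂ v sq q P} {c₁ c₂ : Fin (suc m)} → H₁ ∈ₕ F → H₂ ∈ₕ F →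
                              v ∈ H₁ → v ∈ H₂ → c₁ ∈ H₁ → c₂ ∈ H₂ → toℕ c₁ < toℕ c₂ →
                              CycBetween P (toℕ c₁) (coord sq q) →
                              CycBetween (coord sq q) (toℕ c₂) P →
                              IsEntry F sq q → q ∉ H₁ → q ∉ H₂ → ⊥
  ordered-topvertices-apart {c₁ = c₁} {c₂} H₁∈ H₂∈ v∈₁ v∈₂ c₁∈ c₂∈ c₁<c₂ cy₁ cy₂ eq q∉₁ q∉₂
    with CycBetween-linear (<⇒≤ c₁<c₂) (CycBetween-separate cy₁ cy₂)
  ... | c₁<Q , Q<c₂ with coord-top F eq (<⇒≤ (<-≤-trans Q<c₂ (toℕ≤pred[n] c₂)))
  ...   | q-top , Q≡q = q-top (skippable-between-hyperedges H₁∈ H₂∈ v∈₁ v∈₂ c₁∈ c₂∈ q∉₁ q∉₂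
                          (subst (toℕ c₁ <_) Q≡q c₁<Q) (subst (_< toℕ c₂) Q≡q Q<c₂))

  ordered-bottomvertices-apart : ∀ {H₁ H₂ v sp p Q} {c₁ c₂ : Fin (suc m)} →
                                 H₁ ∈ₕ complementFamily F → H₂ ∈ₕ complementFamily F →
                                 v ∈ H₁ → v ∈ H₂ → c₁ ∈ H₁ → c₂ ∈ H₂ → toℕ c₁ < toℕ c₂ →
                                 CycBetween (coord sp p) (bottomPosition c₁) Q →
                                 CycBetween Q (bottomPosition c₂) (coord sp p) →
                                 IsEntry F sp p → p ∉ H₁ → p ∉ H₂ → ⊥
  ordered-bottomvertices-apart {c₂ = Fin.zero} _ _ _ _ _ _ () _ _ _ _ _
  ordered-bottomvertices-apart {c₁ = Fin.zero} {c₂@(Fin.suc _)}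
                               H₁∈ H₂∈ v∈₁ v∈₂ c₁∈ c₂∈ _ cy₁ cy₂ ep p∉₁ p∉₂
    with CycBetween-to-0 (CycBetween-separate cy₂ cy₁)
  ... | c₂<P with coord-bottom F ep (≤-<-trans (m≤2m∸n (toℕ≤pred[n] c₂)) c₂<P)
                | bottomvertex-left-of F ep c₂<P
  ...   | _ , 0<p , _ | p-bottom , p<c₂ =
    p-bottom (skippable-between-hyperedges H₁∈ H₂∈ v∈₁ v∈₂ c₁∈ c₂∈ p∉₁ p∉₂ 0<p p<c₂)
  ordered-bottomvertices-apart {c₁ = c₁@(Fin.suc _)} {c₂@(Fin.suc _)}
                               H₁∈ H₂∈ v∈₁ v∈₂ c₁∈ c₂∈ c₁<c₂ cy₁ cy₂ ep p∉₁ p∉₂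
    with CycBetween-linear (<⇒≤ (∸-monoʳ-< c₁<c₂ (n≤2m (toℕ≤pred[n] c₂))))
                           (CycBetween-separate cy₂ cy₁)
  ... | c₂<P , P<c₁
    with bottomvertex-left-of F ep c₂<P
       | bottomvertex-right-of F ep (≤-<-trans (m≤2m∸n (toℕ≤pred[n] c₂)) c₂<P) P<c₁
  ... | p-bottom , p<c₂ | _ , c₁<p =
    p-bottom (skippable-between-hyperedges H₁∈ H₂∈ v∈₁ v∈₂ c₁∈ c₂∈ p∉₁ p∉₂ c₁<p p<c₂)

  topvertex-bottomvertex-apart-left : ∀ {H₁ H₂ v sp p Q} {c₁ c₂ : Fin (suc m)} →
    H₁ ∈ₕ F → H₂ ∈ₕ complementFamily F → v ∈ H₁ → v ∈ H₂ → c₁ ∈ H₁ → c₂ ∈ H₂ →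
    CycBetween (coord sp p) (toℕ c₁) Q → CycBetween Q (bottomPosition c₂) (coord sp p) →
    IsEntry F sp p → p ∉ H₁ → p ∉ H₂ → toℕ v < toℕ p → ⊥
  topvertex-bottomvertex-apart-left {sp = sp} {p} {c₁ = c₁} {c₂}
                                    H₁∈ H₂∈ v∈₁ v∈₂ c₁∈ c₂∈ cy₁ cy₂ ep p∉₁ p∉₂ v<p =
    split (before-c₁ c₂ (CycBetween-separate cy₂ cy₁))
    where
    before-c₁ : ∀ c → CycBetween (bottomPosition c) (coord sp p) (toℕ c₁) →
                coord sp p < toℕ c₁ ⊎ 2 * m ∸ toℕ c < coord sp p
    before-c₁ Fin.zero      cy = inj₁ (CycBetween-from-0 cy)
    before-c₁ (Fin.suc _) cy with CycBetween-after⊎before cy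
    ... | inj₁ c<P  = inj₂ c<P
    ... | inj₂ P<c₁ = inj₁ P<c₁

    split : coord sp p < toℕ c₁ ⊎ 2 * m ∸ toℕ c₂ < coord sp p → ⊥
    split (inj₁ P<c₁) with topvertex-left-of F ep P<c₁
    ... | p-top , p<c₁ = p-top (skippable-between H₁∈ v∈₁ c₁∈ p∉₁ v<p p<c₁)
    split (inj₂ c₂<P) with bottomvertex-left-of F ep c₂<P
    ... | p-bottom , p<c₂ = p-bottom (skippable-between H₂∈ v∈₂ c₂∈ p∉₂ v<p p<c₂)

  topvertex-bottomvertex-apart-right : ∀ {H₁ H₂ v sq q P} {c₁ c₂ : Fin (suc m)} →
    H₁ ∈ₕ F → H₂ ∈ₕ complementFamily F → v ∈ H₁ → v ∈ H₂ → c₁ ∈ H₁ → c₂ ∈ H₂ →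
    CycBetween P (toℕ c₁) (coord sq q) → CycBetween (coord sq q) (bottomPosition c₂) P →
    IsEntry F sq q → q ∉ H₁ → q ∉ H₂ → toℕ q < toℕ v → ⊥
  topvertex-bottomvertex-apart-right {sq = sq} {q} {c₁ = c₁} {c₂}
                                     H₁∈ H₂∈ v∈₁ v∈₂ c₁∈ c₂∈ cy₁ cy₂ eq q∉₁ q∉₂ q<v =
    split (after-c₁ c₂ (CycBetween-separate cy₁ cy₂)) (≤-<-connex (coord sq q) m)
    where
    after-c₁ : ∀ c → CycBetween (toℕ c₁) (coord sq q) (bottomPosition c) →
               toℕ c₁ < coord sq q × (m < coord sq q → toℕ c < toℕ q)
    after-c₁ Fin.zero cy = CycBetween-to-0 cy , λ m<Q → proj₁ (proj₂ (coord-bottom F eq m<Q))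
    after-c₁ c@(Fin.suc _) cy
      with CycBetween-linear (≤-trans (toℕ≤pred[n] c₁) (m≤2m∸n (toℕ≤pred[n] c))) cy
    ... | c₁<Q , Q<c = c₁<Q , λ m<Q → proj₂ (bottomvertex-right-of F eq m<Q Q<c)

    split : toℕ c₁ < coord sq q × (m < coord sq q → toℕ c₂ < toℕ q) →
            coord sq q ≤ m ⊎ m < coord sq q → ⊥
    split (c₁<Q , _) (inj₁ Q≤m) with topvertex-right-of F eq Q≤m c₁<Q
    ... | q-top , c₁<q = q-top (skippable-between H₁∈ c₁∈ v∈₁ q∉₁ c₁<q q<v)
    split (_ , c₂<q) (inj₂ m<Q) =
      proj₁ (coord-bottom F eq m<Q) (skippable-between H₂∈ c₂∈ v∈₂ q∉₂ (c₂<q m<Q) q<v)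

module _ {m} (F : Hypergraph (suc m)) (aba : ABAFree F) where

  topvertices-apart : ∀ {H₁ H₂ sp p sq q v} → H₁ ∈ₕ F → H₂ ∈ₕ F →
                      ArcConfined F H₁ sp p sq q → ArcConfined F H₂ sq q sp p →
                      IsEntry F sp p → IsEntry F sq q → v ∈ H₁ → v ∈ H₂ → ⊥
  topvertices-apart {H₁} {H₂} {sp} {p} {sq} {q} H₁∈ H₂∈ arc₁ arc₂ ep eq v∈₁ v∈₂ =
    hyperedge-has-topvertex aba H₁∈ v∈₁ λ (c₁ , c₁∈ , c₁-top) →
    hyperedge-has-topvertex aba H₂∈ v∈₂ λ (c₂ , c₂∈ , c₂-top) →
    compare c₁∈ c₂∈ (occurrence arc₁ {top} c₁∈ c₁-top) (occurrence arc₂ {top} c₂∈ c₂-top)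
            (<-cmp (toℕ c₁) (toℕ c₂))
    where
    compare : ∀ {c₁ c₂} → c₁ ∈ H₁ → c₂ ∈ H₂ →
              CycBetween (coord sp p) (toℕ c₁) (coord sq q) →
              CycBetween (coord sq q) (toℕ c₂) (coord sp p) →
              Tri (toℕ c₁ < toℕ c₂) (toℕ c₁ ≡ toℕ c₂) (toℕ c₂ < toℕ c₁) → ⊥
    compare c₁∈ c₂∈ cy₁ cy₂ (tri< c₁<c₂ _ _) =
      ordered-topvertices-apart F H₁∈ H₂∈ v∈₁ v∈₂ c₁∈ c₂∈ c₁<c₂ cy₁ cy₂ eq (end∉ arc₁) (start∉ arc₂)
    compare c₁∈ c₂∈ cy₁ cy₂ (tri≈ _ c₁≡c₂ _) =
      CycBetween-disjoint cy₁ (subst (λ x → CycBetween (coord sq q) x (coord sp p)) (sym c₁≡c₂) cy₂)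
    compare c₁∈ c₂∈ cy₁ cy₂ (tri> _ _ c₂<c₁) =
      ordered-topvertices-apart F H₂∈ H₁∈ v∈₂ v∈₁ c₂∈ c₁∈ c₂<c₁ cy₂ cy₁ ep (end∉ arc₂) (start∉ arc₁)

  bottomvertices-apart : ∀ {H₁ H₂ sp p sq q v} →
                         H₁ ∈ₕ complementFamily F → H₂ ∈ₕ complementFamily F →
                         ArcConfined F H₁ sp p sq q → ArcConfined F H₂ sq q sp p →
                         IsEntry F sp p → IsEntry F sq q → v ∈ H₁ → v ∈ H₂ → ⊥
  bottomvertices-apart {H₁} {H₂} {sp} {p} {sq} {q} H₁∈ H₂∈ arc₁ arc₂ ep eq v∈₁ v∈₂ =
    hyperedge-has-topvertex (complementFamily-ABAFree aba) H₁∈ v∈₁ λ (c₁ , c₁∈ , c₁-bottom) →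
    hyperedge-has-topvertex (complementFamily-ABAFree aba) H₂∈ v∈₂ λ (c₂ , c₂∈ , c₂-bottom) →
    compare c₁∈ c₂∈ (bottomvertex-occurrence arc₁ c₁∈ c₁-bottom)
            (bottomvertex-occurrence arc₂ c₂∈ c₂-bottom) (<-cmp (toℕ c₁) (toℕ c₂))
    where
    compare : ∀ {c₁ c₂} → c₁ ∈ H₁ → c₂ ∈ H₂ →
              CycBetween (coord sp p) (bottomPosition c₁) (coord sq q) →
              CycBetween (coord sq q) (bottomPosition c₂) (coord sp p) →
              Tri (toℕ c₁ < toℕ c₂) (toℕ c₁ ≡ toℕ c₂) (toℕ c₂ < toℕ c₁) → ⊥
    compare c₁∈ c₂∈ cy₁ cy₂ (tri< c₁<c₂ _ _) =
      ordered-bottomvertices-apart F H₁∈ H₂∈ v∈₁ v∈₂ c₁∈ c₂∈ c₁<c₂ cy₁ cy₂ ep (start∉ arc₁) (end∉ arc₂)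
    compare c₁∈ c₂∈ cy₁ cy₂ (tri≈ _ c₁≡c₂ _) =
      CycBetween-disjoint cy₁
        (subst (λ c → CycBetween (coord sq q) (bottomPosition c) (coord sp p))
               (sym (toℕ-injective c₁≡c₂)) cy₂)
    compare c₁∈ c₂∈ cy₁ cy₂ (tri> _ _ c₂<c₁) =
      ordered-bottomvertices-apart F H₂∈ H₁∈ v∈₂ v∈₁ c₂∈ c₁∈ c₂<c₁ cy₂ cy₁ eq (start∉ arc₂) (end∉ arc₁)

  topvertex-bottomvertex-apart : ∀ {H₁ H₂ sp p sq q v} →
                                 H₁ ∈ₕ F → H₂ ∈ₕ complementFamily F →
                                 ArcConfined F H₁ sp p sq q → ArcConfined F H₂ sq q sp p →
                                 IsEntry F sp p → IsEntry F sq q → v ∈ H₁ → v ∈ H₂ → ⊥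
  topvertex-bottomvertex-apart {H₁} {H₂} {sp} {p} {sq} {q} {v} H₁∈ H₂∈ arc₁ arc₂ ep eq v∈₁ v∈₂ =
    hyperedge-has-topvertex aba H₁∈ v∈₁ λ (c₁ , c₁∈ , c₁-top) →
    hyperedge-has-topvertex (complementFamily-ABAFree aba) H₂∈ v∈₂ λ (c₂ , c₂∈ , c₂-bottom) →
    let cy₁ = occurrence arc₁ {top} c₁∈ c₁-top
        cy₂ = bottomvertex-occurrence arc₂ c₂∈ c₂-bottom
    in case v-beside-endpoints of λ where
         (inj₁ v<p) → topvertex-bottomvertex-apart-left F H₁∈ H₂∈ v∈₁ v∈₂ c₁∈ c₂∈ cy₁ cy₂
                        ep (start∉ arc₁) (end∉ arc₂) v<p
         (inj₂ q<v) → topvertex-bottomvertex-apart-right F H₁∈ H₂∈ v∈₁ v∈₂ c₁∈ c₂∈ cy₁ cy₂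
                        eq (end∉ arc₁) (start∉ arc₂) q<v
    where
    v-beside-endpoints : toℕ v < toℕ p ⊎ toℕ q < toℕ v
    v-beside-endpoints with <-cmp (toℕ v) (toℕ p) | <-cmp (toℕ q) (toℕ v) | ∈-complementFamily⁻ H₂∈
    ... | tri< v<p _ _ | _            | _ = inj₁ v<p
    ... | _            | tri< q<v _ _ | _ = inj₂ q<v
    ... | tri≈ _ v≡p _ | _            | _ =
      ⊥-elim (start∉ arc₁ (subst (_∈ H₁) (toℕ-injective v≡p) v∈₁))
    ... | _            | tri≈ _ q≡v _ | _ =
      ⊥-elim (end∉ arc₁ (subst (_∈ H₁) (toℕ-injective (sym q≡v)) v∈₁))
    ... | tri> _ _ p<v | tri> _ _ v<q | B , B∈ , H₂≡∁B =
      ⊥-elim (aba B∈ H₁∈ p<v v<q (outside-H₂ (end∉ arc₂)) (start∉ arc₁)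
                  (outside-H₂ (start∉ arc₂)) (end∉ arc₁) v∈₁ (x∈∁p⇒x∉p (subst (v ∈_) H₂≡∁B v∈₂)))
      where
      outside-H₂ : ∀ {x} → x ∉ H₂ → x ∈ B
      outside-H₂ x∉ = x∉∁p⇒x∈p (subst (_ ∉_) H₂≡∁B x∉)

mainTheorem20 : (n : ℕ) (F H : Hypergraph n) → ABAFree F → PseudohalfplaneWitness F H →
    (sp sq : Side) (p q : Fin n) → IsEntry F sp p → IsEntry F sq q → p ≢ q →
    ArcNonempty F sp p sq q → ArcNonempty F sq q sp p →
    (H₁ H₂ : Subset n) → H₁ ∈ₕ H → H₂ ∈ₕ H →
    (∀ v → v ∈ H₁ → InC F v → InOpenArc F sp p sq q v) →
    (∀ v → v ∈ H₂ → InC F v → InOpenArc F sq q sp p v) →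
    Empty (H₁ ∩ H₂)
mainTheorem20 zero _ _ _ _ _ _ () _ _ _ _ _ _ _ _ _ _ _ _ _
mainTheorem20 (suc m) F H aba witness sp sq p q ep eq p≢q _ _ H₁ H₂ H₁∈ H₂∈ confined₁ confined₂
              (v , v∈H₁∩H₂) = apart (witness H₁∈) (witness H₂∈)
  where
  arc₁ : ArcConfined F H₁ sp p sq q
  arc₁ = ConfinedTo⇒ArcConfined F (witness H₁∈) ep eq p≢q confined₁

  arc₂ : ArcConfined F H₂ sq q sp p
  arc₂ = ConfinedTo⇒ArcConfined F (witness H₂∈) eq ep (≢-sym p≢q) confined₂

  v∈₁ : v ∈ H₁
  v∈₁ = proj₁ (x∈p∩q⁻ H₁ H₂ v∈H₁∩H₂)

  v∈₂ : v ∈ H₂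
  v∈₂ = proj₂ (x∈p∩q⁻ H₁ H₂ v∈H₁∩H₂)

  apart : H₁ ∈ₕ F ⊎ H₁ ∈ₕ complementFamily F → H₂ ∈ₕ F ⊎ H₂ ∈ₕ complementFamily F → ⊥
  apart (inj₁ H₁∈F) (inj₁ H₂∈F) =
    topvertices-apart F aba H₁∈F H₂∈F arc₁ arc₂ ep eq v∈₁ v∈₂
  apart (inj₂ H₁∈F̄) (inj₂ H₂∈F̄) =
    bottomvertices-apart F aba H₁∈F̄ H₂∈F̄ arc₁ arc₂ ep eq v∈₁ v∈₂
  apart (inj₁ H₁∈F) (inj₂ H₂∈F̄) =
    topvertex-bottomvertex-apart F aba H₁∈F H₂∈F̄ arc₁ arc₂ ep eq v∈₁ v∈₂
  apart (inj₂ H₁∈F̄) (inj₁ H₂∈F) =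
    topvertex-bottomvertex-apart F aba H₂∈F H₁∈F̄ arc₂ arc₁ eq ep v∈₂ v∈₁
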